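{- Let $p,p'$ be coprime integers with $1\le p<p'<2p$, and let $2\le a\le p'-2$ satisfy $\lfloor (a-1)(p'-p)/p'\rfloor=\lfloor (a+1)(p'-p)/p'\rfloor$. Let $a'=a+2\lfloor ap/p'\rfloor$ and $\hat a'=a+2+2\lfloor ap/p'\rfloor$. Then $a'$ and $\hat a'$ are both interfacial in the $(p,p'+2p)$-model.
   Context: For coprime positive integers $q<q'$: for $2\le a\le q'-2$, $a$ is interfacial in the $(q,q')$-model if $\lfloor (a+1)q/q'\rfloor=\lfloor (a-1)q/q'\rfloor+1$; moreover $0$ and $q'$ are always interfacial and $1$ and $q'-1$ are never interfacial. -}

module Defs where

open import Data.Nat using (ℕ; zero; suc; _+_; _*_; _∸_; _≤_; _<_; NonZero)
open import Data.Nat.DivMod using (_/_)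
open import Data.Sum using (_⊎_)
open import Data.Product using (_×_)
open import Relation.Binary.PropositionalEquality using (_≡_)

Interfacial : (q q' : ℕ) → .{{_ : NonZero q'}} → ℕ → Set
Interfacial q q' a =
  (a ≡ 0) ⊎ (a ≡ q') ⊎
  ((2 ≤ a) × (a ≤ q' ∸ 2) × (((a + 1) * q) / q' ≡ ((a ∸ 1) * q) / q' + 1))

{-# OPTIONS --safe #-}
-- Write n = p', r = p' - p and a·p = s + b·n with s < n. As a·p + a·r = a·n, equal floors of
-- (a ∓ 1)·r / n force r < s ≤ p, and s = p would give n ∣ (a - 1)·p, impossible by coprimality.
-- Since (a + 2b)·p = s + b·(n + 2p), modulo N = n + 2p the numbers (a' ∓ 1)·p are s - p and s + p,
-- on either side of a multiple of N because s < p, while (â' ∓ 1)·p are s + p and s + 3p,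
-- on either side of N because s ≥ r.
module Submission where

open import Defs
open import Data.Nat using (ℕ; zero; suc; _+_; _*_; _∸_; _≤_; _<_; NonZero; s≤s; z≤n; >-nonZero)
open import Data.Nat.DivMod using (_/_; _%_; m≡m%n+[m/n]*n; m%n<n; m*n/n≡m; m<n⇒m/n≡0; m/n≡0⇒m<n; /-congˡ; +-distrib-/-∣ʳ)
open import Data.Nat.Divisibility using (_∣_; _∤_; divides; n∣m*n; ∣m+n∣m⇒∣n; >⇒∤)
open import Data.Nat.Coprimality using (Coprime; coprime-divisor) renaming (sym to sym-coprime)
open import Data.Nat.Properties
open import Algebra.Properties.CommutativeSemigroup +-commutativeSemigroup using () renaming (xy∙z≈xz∙y to +-right-comm)
open import Data.Nat.Tactic.RingSolver using (solve-∀)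
open import Data.Product using (_×_; _,_; proj₁; proj₂)
open import Data.Sum using (inj₂)
open import Relation.Binary.PropositionalEquality using (_≡_; _≢_; refl; sym; trans; cong; cong₂; subst; module ≡-Reasoning)
open import Relation.Nullary using (contradiction)

[m+kn]/n≡m/n+k : ∀ m k {n} .{{_ : NonZero n}} → (m + k * n) / n ≡ m / n + k
[m+kn]/n≡m/n+k m k {n} = trans (+-distrib-/-∣ʳ m (n∣m*n k)) (cong (m / n +_) (m*n/n≡m k n))

[m+kn]/n≡k : ∀ {m n} k .{{_ : NonZero n}} → m < n → (m + k * n) / n ≡ k
[m+kn]/n≡k {m} k m<n = trans ([m+kn]/n≡m/n+k m k) (cong (_+ k) (m<n⇒m/n≡0 m<n))

m/n≡[m+o]/n⇒m%n+o<n : ∀ m o {n} .{{_ : NonZero n}} → m / n ≡ (m + o) / n → m % n + o < n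
m/n≡[m+o]/n⇒m%n+o<n m o {n} eq = m/n≡0⇒m<n (+-cancelʳ-≡ (m / n) _ 0 (begin
  (m % n + o) / n + m / n      ≡⟨ [m+kn]/n≡m/n+k (m % n + o) (m / n) ⟨
  (m % n + o + m / n * n) / n  ≡⟨ /-congˡ (+-right-comm (m % n) o _) ⟩
  (m % n + m / n * n + o) / n  ≡⟨ /-congˡ (cong (_+ o) (m≡m%n+[m/n]*n m n)) ⟨
  (m + o) / n                  ≡⟨ eq ⟨
  m / n                        ∎))
  where open ≡-Reasoning

m∣n∧0<n<2m⇒n≡m : ∀ {m n} → m ∣ n → 0 < n → n < 2 * m → n ≡ m
m∣n∧0<n<2m⇒n≡m {m} (divides j refl) 0<n n<2m with j | *-cancelʳ-< m j 2 n<2m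
... | zero        | _               = contradiction 0<n (<-irrefl refl)
... | suc zero    | _               = +-identityʳ m
... | suc (suc _) | s≤s (s≤s ())

coprime⇒∤* : ∀ {n p c} → Coprime n p → 0 < c → c < n → n ∤ c * p
coprime⇒∤* {n} {p} {c} cop 0<c c<n n∣cp =
  >⇒∤ {{>-nonZero 0<c}} c<n (coprime-divisor cop (subst (n ∣_) (*-comm c p) n∣cp))

[m+1]*n≡[m∸1]*n+2*n : ∀ {m} n → 1 ≤ m → (m + 1) * n ≡ (m ∸ 1) * n + 2 * n
[m+1]*n≡[m∸1]*n+2*n {suc k} n _ = trans (cong (_* n) (sym (+-suc k 1))) (*-distribʳ-+ n k 2)

interfacial-if-straddles : ∀ {q N} .{{_ : NonZero N}} x m {u v} →
  2 ≤ x → x + 2 ≤ N →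
  (x ∸ 1) * q ≡ u + m * N → u < N →
  u + 2 * q ≡ v + N → v < N →
  Interfacial q N x
interfacial-if-straddles {q} {N} x m {u} {v} 2≤x x+2≤N below u<N above v<N =
  inj₂ (inj₂ (2≤x , m+n≤o⇒m≤o∸n x x+2≤N , floors))
  where
  open ≡-Reasoning
  floors : (x + 1) * q / N ≡ (x ∸ 1) * q / N + 1
  floors = begin
    (x + 1) * q / N         ≡⟨ /-congˡ (begin
        (x + 1) * q             ≡⟨ [m+1]*n≡[m∸1]*n+2*n q (≤-trans (s≤s z≤n) 2≤x) ⟩
        (x ∸ 1) * q + 2 * q     ≡⟨ cong (_+ 2 * q) below ⟩
        u + m * N + 2 * q       ≡⟨ +-right-comm u (m * N) (2 * q) ⟩
        u + 2 * q + m * N       ≡⟨ cong (_+ m * N) above ⟩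
        v + N + m * N           ≡⟨ +-assoc v N (m * N) ⟩
        v + suc m * N           ∎) ⟩
    (v + suc m * N) / N     ≡⟨ [m+kn]/n≡k (suc m) v<N ⟩
    suc m                   ≡⟨ +-comm 1 m ⟩
    m + 1                   ≡⟨ cong (_+ 1) ([m+kn]/n≡k m u<N) ⟨
    (u + m * N) / N + 1     ≡⟨ cong (λ y → y / N + 1) below ⟨
    (x ∸ 1) * q / N + 1     ∎

-- Since a·p + a·r = a·n, the residue e of (a - 1)·r and the residue s of a·p satisfy
-- e + s + r ≡ 0 (mod n); equal floors mean e + 2r < n, which forces e + s + r = n.
residue-bounds : ∀ {p r a b s} .{{_ : NonZero (p + r)}} → 0 < r → 1 ≤ a →
  a * p ≡ s + b * (p + r) → s < p + r →
  ((a ∸ 1) * r) / (p + r) ≡ ((a + 1) * r) / (p + r) →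
  r < s × s ≤ p
residue-bounds {p} {r} {suc a₁} {b} {s} 0<r 1≤a ap≡ s<n floors = r<s , s≤p
  where
  n = p + r
  e = a₁ * r % n
  k = a₁ * r / n

  gap : e + 2 * r < n
  gap = m/n≡[m+o]/n⇒m%n+o<n (a₁ * r) (2 * r) (trans floors (/-congˡ ([m+1]*n≡[m∸1]*n+2*n r 1≤a)))

  regroup : ∀ k b n e s r → (k + b) * n + (e + s + r) ≡ (e + k * n) + (s + b * n) + r
  regroup = solve-∀
  collect : ∀ a₁ p r → a₁ * r + (1 + a₁) * p + r ≡ (1 + a₁) * (p + r)
  collect = solve-∀

  total : (k + b) * n + (e + s + r) ≡ suc a₁ * n
  total = begin
    (k + b) * n + (e + s + r)      ≡⟨ regroup k b n e s r ⟩
    (e + k * n) + (s + b * n) + r  ≡⟨ cong₂ (λ x y → x + y + r) (m≡m%n+[m/n]*n (a₁ * r) n) ap≡ ⟨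
    a₁ * r + suc a₁ * p + r        ≡⟨ collect a₁ p r ⟩
    suc a₁ * n                     ∎
    where open ≡-Reasoning

  sum≡n : e + s + r ≡ n
  sum≡n = m∣n∧0<n<2m⇒n≡m
    (∣m+n∣m⇒∣n (subst (n ∣_) (sym total) (n∣m*n (suc a₁))) (n∣m*n (k + b)))
    (≤-trans 0<r (m≤n+m r (e + s)))
    (begin-strict
      e + s + r  ≡⟨ +-right-comm e s r ⟩
      e + r + s  <⟨ +-mono-< (≤-<-trans (+-monoʳ-≤ e (m≤m+n r (r + 0))) gap) s<n ⟩
      n + n      ≡⟨ cong (n +_) (+-identityʳ n) ⟨
      2 * n      ∎)
    where open ≤-Reasoning

  r<s : r < s
  r<s = +-cancelˡ-< (e + r) r s (begin-strict
    e + r + r    ≡⟨ +-assoc e r r ⟩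
    e + (r + r)  ≡⟨ cong (λ t → e + (r + t)) (+-identityʳ r) ⟨
    e + 2 * r    <⟨ gap ⟩
    n            ≡⟨ sum≡n ⟨
    e + s + r    ≡⟨ +-right-comm e s r ⟩
    e + r + s    ∎)
    where open ≤-Reasoning

  s≤p : s ≤ p
  s≤p = subst (s ≤_) (+-cancelʳ-≡ r (e + s) p sum≡n) (m≤n+m s e)

residue≢ : ∀ {p n a b s} → Coprime n p → 2 ≤ a → a < n → a * p ≡ s + b * n → s ≢ p
residue≢ {p} {n} {suc a₁} {b} cop (s≤s 1≤a₁) a<n ap≡ refl =
  coprime⇒∤* cop 1≤a₁ (<-trans (n<1+n a₁) a<n) (divides b (+-cancelˡ-≡ p _ _ ap≡))

interfacial-shift : ∀ {p n a b s} .{{_ : NonZero (n + 2 * p)}} →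
  2 ≤ a → a + 2 ≤ n → suc b ≤ p →
  a * p ≡ s + b * n → n ≤ s + p → s + p < n + 2 * p →
  Interfacial p (n + 2 * p) (a + 2 * suc b)
interfacial-shift {p} {n} {suc a₁} {b} {s} 2≤a a+2≤n b<p ap≡ n≤s+p s+p<N =
  interfacial-if-straddles (suc a₁ + 2 * suc b) b
    (≤-trans 2≤a (m≤m+n (suc a₁) (2 * suc b))) x+2≤N below s+p<N above
    (≤-<-trans (m∸n≤m (s + p) n) s+p<N)
  where
  N = n + 2 * p

  x+2≤N : suc a₁ + 2 * suc b + 2 ≤ N
  x+2≤N = begin
    suc a₁ + 2 * suc b + 2  ≡⟨ +-right-comm (suc a₁) (2 * suc b) 2 ⟩
    suc a₁ + 2 + 2 * suc b  ≤⟨ +-mono-≤ a+2≤n (*-monoʳ-≤ 2 b<p) ⟩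
    N                       ∎
    where open ≤-Reasoning

  split : ∀ a₁ b p → (a₁ + 2 * (1 + b)) * p ≡ (1 + a₁) * p + (p + b * (2 * p))
  split = solve-∀
  merge : ∀ s b n p → s + b * n + (p + b * (2 * p)) ≡ s + p + b * (n + 2 * p)
  merge = solve-∀

  below : (a₁ + 2 * suc b) * p ≡ s + p + b * N
  below = begin
    (a₁ + 2 * suc b) * p            ≡⟨ split a₁ b p ⟩
    suc a₁ * p + (p + b * (2 * p))  ≡⟨ cong (_+ (p + b * (2 * p))) ap≡ ⟩
    s + b * n + (p + b * (2 * p))   ≡⟨ merge s b n p ⟩
    s + p + b * N                   ∎
    where open ≡-Reasoning

  above : s + p + 2 * p ≡ (s + p ∸ n) + N
  above = trans (cong (_+ 2 * p) (sym (m∸n+n≡m n≤s+p))) (+-assoc (s + p ∸ n) n (2 * p))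

quotient< : ∀ {p n a b s} → 0 < p → a < n → a * p ≡ s + b * n → b < p
quotient< {p} {n} {a} {b} {s} 0<p a<n ap≡ = *-cancelʳ-< n b p (begin-strict
  b * n      ≤⟨ m≤n+m (b * n) s ⟩
  s + b * n  ≡⟨ ap≡ ⟨
  a * p      <⟨ *-monoˡ-< p {{>-nonZero 0<p}} a<n ⟩
  n * p      ≡⟨ *-comm n p ⟩
  p * n      ∎)
  where open ≤-Reasoning

shifted-pair-interfacial : ∀ {p r a b s} .{{_ : NonZero (p + r + 2 * p)}} →
  2 ≤ a → a + 2 ≤ p + r → a * p ≡ s + b * (p + r) → r ≤ s → s < p →
  Interfacial p (p + r + 2 * p) (a + 2 * b) × Interfacial p (p + r + 2 * p) (a + 2 + 2 * b)
shifted-pair-interfacial {p} {r} {a} {zero} {s} 2≤a _ ap≡ _ s<p = contradiction p≤s (<⇒≱ s<p)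
  where
  p≤s : p ≤ s
  p≤s = ≤-trans (m≤n*m p a {{>-nonZero (≤-trans (s≤s z≤n) 2≤a)}}) (≤-reflexive (trans ap≡ (+-identityʳ s)))
shifted-pair-interfacial {p} {r} {a} {suc c} {s} 2≤a a+2≤n ap≡ r≤s s<p =
  interfacial-shift 2≤a a+2≤n (<⇒≤ b<p) ap≡′ (≤-trans (m≤n+m n s) (m≤m+n (s + n) p)) s+n+p<N ,
  subst (Interfacial p N) (reassoc a c) (interfacial-shift 2≤a a+2≤n b<p ap≡ n≤s+p s+p<N)
  where
  n = p + r
  N = n + 2 * p

  ap≡′ : a * p ≡ (s + n) + c * n
  ap≡′ = trans ap≡ (sym (+-assoc s n (c * n)))

  n≤s+p : n ≤ s + p
  n≤s+p = ≤-trans (+-monoʳ-≤ p r≤s) (≤-reflexive (+-comm p s))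

  b<p : suc c < p
  b<p = quotient< {s = s} (m<n⇒0<n s<p) (<-≤-trans (m<m+n a (s≤s z≤n)) a+2≤n) ap≡

  s+p<2p : s + p < 2 * p
  s+p<2p = <-≤-trans (+-monoˡ-< p s<p) (≤-reflexive (cong (p +_) (sym (+-identityʳ p))))

  s+p<N : s + p < N
  s+p<N = <-≤-trans s+p<2p (m≤n+m (2 * p) n)

  s+n+p<N : s + n + p < N
  s+n+p<N = begin-strict
    s + n + p    ≡⟨ cong (_+ p) (+-comm s n) ⟩
    n + s + p    ≡⟨ +-assoc n s p ⟩
    n + (s + p)  <⟨ +-monoʳ-< n s+p<2p ⟩
    N            ∎
    where open ≤-Reasoning

  reassoc : ∀ a c → a + 2 * (1 + (1 + c)) ≡ a + 2 + 2 * (1 + c)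
  reassoc = solve-∀

lemmaD3 : (p p' a : ℕ) → .{{_ : NonZero p'}} → .{{_ : NonZero (p' + 2 * p)}} →
    Coprime p p' → 1 ≤ p → p < p' → p' < 2 * p →
    2 ≤ a → a ≤ p' ∸ 2 →
    ((a ∸ 1) * (p' ∸ p)) / p' ≡ ((a + 1) * (p' ∸ p)) / p' →
    Interfacial p (p' + 2 * p) (a + 2 * ((a * p) / p'))
      × Interfacial p (p' + 2 * p) (a + 2 + 2 * ((a * p) / p'))
lemmaD3 p p' a cop 1≤p p<p' _ 2≤a a≤p'∸2 floors with m≤n⇒∃[o]m+o≡n (<⇒≤ p<p')
... | r , refl = shifted-pair-interfacial {b = b} 2≤a a+2≤n ap≡ (<⇒≤ (proj₁ bounds)) s<p
  where
  n = p + r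
  s = a * p % n
  b = a * p / n

  ap≡ : a * p ≡ s + b * n
  ap≡ = m≡m%n+[m/n]*n (a * p) n

  a+2≤n : a + 2 ≤ n
  a+2≤n = m≤o∸n⇒m+n≤o a (≤-trans (s≤s 1≤p) p<p') a≤p'∸2

  0<r : 0 < r
  0<r = +-cancelˡ-< p 0 r (subst (_< n) (sym (+-identityʳ p)) p<p')

  floors′ : ((a ∸ 1) * r) / n ≡ ((a + 1) * r) / n
  floors′ = subst (λ t → ((a ∸ 1) * t) / n ≡ ((a + 1) * t) / n) (m+n∸m≡n p r) floors

  bounds : r < s × s ≤ p
  bounds = residue-bounds {b = b} 0<r (≤-trans (s≤s z≤n) 2≤a) ap≡ (m%n<n (a * p) n) floors′

  s<p : s < p
  s<p = ≤∧≢⇒< (proj₂ bounds)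
    (residue≢ {b = b} (sym-coprime cop) 2≤a (<-≤-trans (m<m+n a (s≤s z≤n)) a+2≤n) ap≡)
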